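{- Let $\mathsf{L}$ be an intermediate logic with $\mathsf{ND}\subseteq\mathsf{L}$, and let $\phi$ be a formula consistent in $\mathsf{L}^\neg$. Then $\vdash_{\mathsf{L}^\neg}\phi\leftrightarrow\neg\neg\phi$ if and only if $\phi$ is $\mathcal{ST}$-projective in $\mathsf{L}^\neg$, where $\mathcal{ST}$ is the class of substitutions stable in $\mathsf{L}^\neg$.
   Context: Formulas are those of intuitionistic propositional logic (variables, $\bot,\top$, $\wedge,\vee,\to$; $\neg\phi:=\phi\to\bot$). An intermediate theory is a set $\mathsf{T}$ of formulas closed under modus ponens with $\mathsf{IPC}\subseteq\mathsf{T}\subseteq\mathsf{CPC}$; an intermediate logic is an intermediate theory closed under uniform substitution. $\Gamma\vdash_{\mathsf{T}}\phi$ means $\phi$ is derivable from $\mathsf{T}\cup\Gamma$ by modus ponens; $\vdash_{\mathsf{T}}\phi$ means $\phi\in\mathsf{T}$. $\psi$ is consistent in $\mathsf{T}$ if $\neg\psi\notin\mathsf{T}$. $\mathsf{ND}$ is the smallest intermediate logic containing all instances of $(\neg\phi\to\bigvee_{i=1}^k\neg\psi_i)\to\bigvee_{i=1}^k(\neg\phi\to\neg\psi_i)$ for all $k\geq1$. The negative variant of an intermediate logic $\mathsf{L}$ is $\mathsf{L}^\neg=\{\phi\mid\phi^\neg\in\mathsf{L}\}$, where $\phi^\neg$ replaces each variable $p$ by $\neg p$. A substitution $\sigma$ (map on formulas commuting with connectives) is stable in $\mathsf{L}^\neg$ if $\vdash_{\mathsf{L}^\neg}\sigma(p)\leftrightarrow\neg\neg\sigma(p)$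 for all variables $p$. $\psi$ is $\mathcal{ST}$-projective in $\mathsf{L}^\neg$ if there is $\sigma\in\mathcal{ST}$ with $\vdash_{\mathsf{L}^\neg}\sigma(\psi)$ and, for every variable $p$, $\psi,\sigma(p)\vdash_{\mathsf{L}^\neg}p$ and $\psi,p\vdash_{\mathsf{L}^\neg}\sigma(p)$. -}

module Defs where

open import Data.Nat using (ℕ)
open import Data.Bool using (Bool; true; false; _∧_; _∨_; not)
open import Data.List using (List; []; _∷_)
open import Data.List.Membership.Propositional using (_∈_)
open import Data.Product using (Σ; _×_)
open import Relation.Binary.PropositionalEquality using (_≡_)
open import Relation.Nullary using (¬_)

infixr 6 _∧'_
infixr 5 _∨'_
infixr 4 _⇒_

data Formula : Set where
  var  : ℕ → Formula
  ⊥'   : Formula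
  ⊤'   : Formula
  _∧'_ : Formula → Formula → Formula
  _∨'_ : Formula → Formula → Formula
  _⇒_  : Formula → Formula → Formula

¬' : Formula → Formula
¬' φ = φ ⇒ ⊥'

_⇔_ : Formula → Formula → Formula
φ ⇔ ψ = (φ ⇒ ψ) ∧' (ψ ⇒ φ)

Subst : Set
Subst = ℕ → Formula

sub : Subst → Formula → Formula
sub σ (var p)  = σ p
sub σ ⊥'       = ⊥'
sub σ ⊤'       = ⊤'
sub σ (a ∧' b) = sub σ a ∧' sub σ b
sub σ (a ∨' b) = sub σ a ∨' sub σ b
sub σ (a ⇒ b)  = sub σ a ⇒ sub σ b

Theory : Set₁
Theory = Formula → Set

_⊆_ : Theory → Theory → Set
S ⊆ T = ∀ φ → S φ → T φ

data IPCAx : Formula → Set where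
  axK   : ∀ a b   → IPCAx (a ⇒ b ⇒ a)
  axS   : ∀ a b c → IPCAx ((a ⇒ b ⇒ c) ⇒ (a ⇒ b) ⇒ a ⇒ c)
  ax∧I  : ∀ a b   → IPCAx (a ⇒ b ⇒ a ∧' b)
  ax∧E₁ : ∀ a b   → IPCAx (a ∧' b ⇒ a)
  ax∧E₂ : ∀ a b   → IPCAx (a ∧' b ⇒ b)
  ax∨I₁ : ∀ a b   → IPCAx (a ⇒ a ∨' b)
  ax∨I₂ : ∀ a b   → IPCAx (b ⇒ a ∨' b)
  ax∨E  : ∀ a b c → IPCAx ((a ⇒ c) ⇒ (b ⇒ c) ⇒ a ∨' b ⇒ c)
  ax⊥E  : ∀ a     → IPCAx (⊥' ⇒ a)
  ax⊤   : IPCAx ⊤'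

data IPC : Formula → Set where
  ax : ∀ {φ} → IPCAx φ → IPC φ
  mp : ∀ {φ ψ} → IPC (φ ⇒ ψ) → IPC φ → IPC ψ

eval : (ℕ → Bool) → Formula → Bool
eval v (var p)  = v p
eval v ⊥'       = false
eval v ⊤'       = true
eval v (a ∧' b) = eval v a ∧ eval v b
eval v (a ∨' b) = eval v a ∨ eval v b
eval v (a ⇒ b)  = not (eval v a) ∨ eval v b

CPC : Theory
CPC φ = ∀ (v : ℕ → Bool) → eval v φ ≡ true

ClosedMP : Theory → Set
ClosedMP T = ∀ φ ψ → T (φ ⇒ ψ) → T φ → T ψ

ClosedSubst : Theory → Set
ClosedSubst T = ∀ (σ : Subst) φ → T φ → T (sub σ φ)

record IntermediateTheory (T : Theory) : Set where
  field
    closedMP : ClosedMP T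
    ipc⊆     : IPC ⊆ T
    ⊆cpc     : T ⊆ CPC

record IntermediateLogic (L : Theory) : Set where
  field
    intermediate : IntermediateTheory L
    closedSubst  : ClosedSubst L

data _⊢[_]_ (Γ : List Formula) (T : Theory) : Formula → Set where
  thm : ∀ {φ} → T φ → Γ ⊢[ T ] φ
  hyp : ∀ {φ} → φ ∈ Γ → Γ ⊢[ T ] φ
  mp  : ∀ {φ ψ} → Γ ⊢[ T ] (φ ⇒ ψ) → Γ ⊢[ T ] φ → Γ ⊢[ T ] ψ

⋁ : Formula → List Formula → Formula
⋁ a []       = a
⋁ a (b ∷ bs) = a ∨' ⋁ b bs

⋁map : (Formula → Formula) → Formula → List Formula → Formula
⋁map f a []       = f a
⋁map f a (b ∷ bs) = f a ∨' ⋁map f b bs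

mapF : (Formula → Formula) → List Formula → List Formula
mapF f []       = []
mapF f (b ∷ bs) = f b ∷ mapF f bs

-- ND axiom instances: (¬φ → ⋁ᵢ ¬ψᵢ) → ⋁ᵢ (¬φ → ¬ψᵢ), k ≥ 1
NDAxiom : Formula → Set
NDAxiom χ = Σ Formula λ φ → Σ Formula λ ψ₁ → Σ (List Formula) λ ψs →
  χ ≡ ((¬' φ ⇒ ⋁map ¬' ψ₁ ψs) ⇒ ⋁map (λ ψ → ¬' φ ⇒ ¬' ψ) ψ₁ ψs)

data ND : Formula → Set where
  ipc  : ∀ {φ} → IPC φ → ND φ
  ndax : ∀ {φ} → NDAxiom φ → ND φ
  mp   : ∀ {φ ψ} → ND (φ ⇒ ψ) → ND φ → ND ψ
  subst : ∀ {φ} (σ : Subst) → ND φ → ND (sub σ φ)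

neg-var : Subst
neg-var p = ¬' (var p)

_^¬ : Formula → Formula
φ ^¬ = sub neg-var φ

Neg : Theory → Theory
Neg L φ = L (φ ^¬)

Consistent : Theory → Formula → Set
Consistent T ψ = ¬ T (¬' ψ)

Stable : Theory → Subst → Set
Stable T σ = ∀ p → T (σ p ⇔ ¬' (¬' (σ p)))

STProjective : Theory → Formula → Set
STProjective T ψ = Σ Subst λ σ → Stable T σ × T (sub σ ψ) ×
  (∀ p → ((ψ ∷ σ p ∷ []) ⊢[ T ] var p) × ((ψ ∷ var p ∷ []) ⊢[ T ] σ p))

-- In L^¬ every variable is stable, since its image ¬p is stable in IPC, and L^¬ is
-- closed under stable substitutions.  If σ is a stable substitution witnessing the
-- projectivity of φ, then p ↔ σ p under φ, hence also under ¬¬φ because both sides are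
-- stable; so ¬¬φ proves φ ↔ σ φ, and σ φ is a theorem.  Conversely, a consistent φ is
-- classically satisfiable (Kalmár: an unsatisfiable formula is refuted already in IPC);
-- for a satisfying valuation v put σ p := φ → p if v p, and φ ∧ p otherwise.  This σ is
-- stable when φ is, agrees with the identity under φ and with the constant substitution
-- v under ¬φ, so σ φ follows from φ and from ¬φ; being stable, σ φ is a theorem.
module Submission where

open import Defs hiding (subst)
open import Data.Bool using (Bool; true; false; if_then_else_; not)
  renaming (_∧_ to _&&_; _∨_ to _||_)
open import Data.Empty using (⊥-elim)
open import Data.List using (List; []; _∷_)
open import Data.List.Membership.Propositional using (_∈_)
open import Data.List.Relation.Unary.Any using (here; there)
open import Data.Nat using (ℕ; zero; suc; _<_; _≤_; s≤s; _⊔_; s≤s⁻¹)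
open import Data.Nat.Properties using (_≟_; ≤-refl; ≤∧≢⇒<; <-≤-trans; m≤m⊔n; m≤n⊔m)
open import Data.Product using (Σ; _×_; _,_; proj₁; proj₂)
open import Data.Sum using (_⊎_; inj₁; inj₂)
open import Data.Unit using (tt) renaming (⊤ to Unit)
open import Function using (_∘_)
open import Relation.Binary.PropositionalEquality using (_≡_; refl; sym; trans; cong₂; subst)
open import Relation.Nullary using (yes; no)

sub-var : ∀ χ → sub var χ ≡ χ
sub-var (var p)  = refl
sub-var ⊥'       = refl
sub-var ⊤'       = refl
sub-var (a ∧' b) = cong₂ _∧'_ (sub-var a) (sub-var b)
sub-var (a ∨' b) = cong₂ _∨'_ (sub-var a) (sub-var b)
sub-var (a ⇒ b)  = cong₂ _⇒_ (sub-var a) (sub-var b)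

sub-sub : ∀ τ σ χ → sub τ (sub σ χ) ≡ sub (sub τ ∘ σ) χ
sub-sub τ σ (var p)  = refl
sub-sub τ σ ⊥'       = refl
sub-sub τ σ ⊤'       = refl
sub-sub τ σ (a ∧' b) = cong₂ _∧'_ (sub-sub τ σ a) (sub-sub τ σ b)
sub-sub τ σ (a ∨' b) = cong₂ _∨'_ (sub-sub τ σ a) (sub-sub τ σ b)
sub-sub τ σ (a ⇒ b)  = cong₂ _⇒_ (sub-sub τ σ a) (sub-sub τ σ b)

eval-sub : ∀ v σ χ → eval v (sub σ χ) ≡ eval (eval v ∘ σ) χ
eval-sub v σ (var p)  = refl
eval-sub v σ ⊥'       = refl
eval-sub v σ ⊤'       = refl
eval-sub v σ (a ∧' b) = cong₂ _&&_ (eval-sub v σ a) (eval-sub v σ b)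
eval-sub v σ (a ∨' b) = cong₂ _||_ (eval-sub v σ a) (eval-sub v σ b)
eval-sub v σ (a ⇒ b)  = cong₂ (λ x y → not x || y) (eval-sub v σ a) (eval-sub v σ b)

VarsBelow : ℕ → Formula → Set
VarsBelow n (var p)  = p < n
VarsBelow n ⊥'       = Unit
VarsBelow n ⊤'       = Unit
VarsBelow n (a ∧' b) = VarsBelow n a × VarsBelow n b
VarsBelow n (a ∨' b) = VarsBelow n a × VarsBelow n b
VarsBelow n (a ⇒ b)  = VarsBelow n a × VarsBelow n b

varBound : Formula → ℕ
varBound (var p)  = suc p
varBound ⊥'       = 0
varBound ⊤'       = 0
varBound (a ∧' b) = varBound a ⊔ varBound b
varBound (a ∨' b) = varBound a ⊔ varBound b
varBound (a ⇒ b)  = varBound a ⊔ varBound b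

VarsBelow-mono : ∀ {m n} χ → m ≤ n → VarsBelow m χ → VarsBelow n χ
VarsBelow-mono (var p)  m≤n p<m     = <-≤-trans p<m m≤n
VarsBelow-mono ⊥'       m≤n _       = tt
VarsBelow-mono ⊤'       m≤n _       = tt
VarsBelow-mono (a ∧' b) m≤n (ha , hb) = VarsBelow-mono a m≤n ha , VarsBelow-mono b m≤n hb
VarsBelow-mono (a ∨' b) m≤n (ha , hb) = VarsBelow-mono a m≤n ha , VarsBelow-mono b m≤n hb
VarsBelow-mono (a ⇒ b)  m≤n (ha , hb) = VarsBelow-mono a m≤n ha , VarsBelow-mono b m≤n hb

VarsBelow-⊔ : ∀ a b → VarsBelow (varBound a) a → VarsBelow (varBound b) b →
              VarsBelow (varBound a ⊔ varBound b) a × VarsBelow (varBound a ⊔ varBound b) b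
VarsBelow-⊔ a b ha hb = VarsBelow-mono a (m≤m⊔n (varBound a) (varBound b)) ha ,
                        VarsBelow-mono b (m≤n⊔m (varBound a) (varBound b)) hb

VarsBelow-varBound : ∀ χ → VarsBelow (varBound χ) χ
VarsBelow-varBound (var p)  = s≤s ≤-refl
VarsBelow-varBound ⊥'       = tt
VarsBelow-varBound ⊤'       = tt
VarsBelow-varBound (a ∧' b) = VarsBelow-⊔ a b (VarsBelow-varBound a) (VarsBelow-varBound b)
VarsBelow-varBound (a ∨' b) = VarsBelow-⊔ a b (VarsBelow-varBound a) (VarsBelow-varBound b)
VarsBelow-varBound (a ⇒ b)  = VarsBelow-⊔ a b (VarsBelow-varBound a) (VarsBelow-varBound b)

VarsBelow-sub : ∀ {m n σ} χ → VarsBelow m χ → (∀ p → p < m → VarsBelow n (σ p)) →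
                VarsBelow n (sub σ χ)
VarsBelow-sub (var p)  p<m       σ<n = σ<n p p<m
VarsBelow-sub ⊥'       _         σ<n = tt
VarsBelow-sub ⊤'       _         σ<n = tt
VarsBelow-sub (a ∧' b) (ha , hb) σ<n = VarsBelow-sub a ha σ<n , VarsBelow-sub b hb σ<n
VarsBelow-sub (a ∨' b) (ha , hb) σ<n = VarsBelow-sub a ha σ<n , VarsBelow-sub b hb σ<n
VarsBelow-sub (a ⇒ b)  (ha , hb) σ<n = VarsBelow-sub a ha σ<n , VarsBelow-sub b hb σ<n

sub-cong-VarsBelow : ∀ {n σ τ} χ → VarsBelow n χ → (∀ p → p < n → σ p ≡ τ p) →
                     sub σ χ ≡ sub τ χ
sub-cong-VarsBelow (var p)  p<n       σ≡τ = σ≡τ p p<n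
sub-cong-VarsBelow ⊥'       _         σ≡τ = refl
sub-cong-VarsBelow ⊤'       _         σ≡τ = refl
sub-cong-VarsBelow (a ∧' b) (ha , hb) σ≡τ = cong₂ _∧'_ (sub-cong-VarsBelow a ha σ≡τ) (sub-cong-VarsBelow b hb σ≡τ)
sub-cong-VarsBelow (a ∨' b) (ha , hb) σ≡τ = cong₂ _∨'_ (sub-cong-VarsBelow a ha σ≡τ) (sub-cong-VarsBelow b hb σ≡τ)
sub-cong-VarsBelow (a ⇒ b)  (ha , hb) σ≡τ = cong₂ _⇒_ (sub-cong-VarsBelow a ha σ≡τ) (sub-cong-VarsBelow b hb σ≡τ)

sub-closed : ∀ σ χ → VarsBelow 0 χ → sub σ χ ≡ χ
sub-closed σ χ χ-closed = trans (sub-cong-VarsBelow χ χ-closed (λ _ ())) (sub-var χ)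

assign : ℕ → Formula → Subst
assign n c p with p ≟ n
... | yes _ = c
... | no  _ = var p

VarsBelow-assign : ∀ n c → VarsBelow n c → ∀ p → p < suc n → VarsBelow n (assign n c p)
VarsBelow-assign n c c<n p p<1+n with p ≟ n
... | yes _   = c<n
... | no  p≢n = ≤∧≢⇒< (s≤s⁻¹ p<1+n) p≢n

valuationSubst : (ℕ → Bool) → Subst
valuationSubst v p = if v p then ⊤' else ⊥'

Satisfiable : Formula → Set
Satisfiable χ = Σ (ℕ → Bool) λ v → eval v χ ≡ true

module Derivations (T : Theory) (IPC⊆T : IPC ⊆ T) (T-closedMP : ClosedMP T) where

  infix 2 _⊢_
  _⊢_ : List Formula → Formula → Set
  Γ ⊢ φ = Γ ⊢[ T ] φ

  ⊢⇒T : ∀ {φ} → [] ⊢ φ → T φ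
  ⊢⇒T (thm φ∈T) = φ∈T
  ⊢⇒T (hyp ())
  ⊢⇒T (mp d e)  = T-closedMP _ _ (⊢⇒T d) (⊢⇒T e)

  axiom : ∀ {Γ φ} → IPCAx φ → Γ ⊢ φ
  axiom a = thm (IPC⊆T _ (ax a))

  weaken : ∀ {Γ Δ φ} → (∀ {x} → x ∈ Γ → x ∈ Δ) → Γ ⊢ φ → Δ ⊢ φ
  weaken Γ⊆Δ (thm φ∈T) = thm φ∈T
  weaken Γ⊆Δ (hyp φ∈Γ) = hyp (Γ⊆Δ φ∈Γ)
  weaken Γ⊆Δ (mp d e)  = mp (weaken Γ⊆Δ d) (weaken Γ⊆Δ e)

  weaken₁ : ∀ {Γ a φ} → Γ ⊢ φ → (a ∷ Γ) ⊢ φ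
  weaken₁ = weaken there

  weaken[] : ∀ {Γ φ} → [] ⊢ φ → Γ ⊢ φ
  weaken[] = weaken λ ()

  weaken-skip : ∀ {Γ a b φ} → (a ∷ Γ) ⊢ φ → (a ∷ b ∷ Γ) ⊢ φ
  weaken-skip = weaken λ { (here e) → here e ; (there x∈Γ) → there (there x∈Γ) }

  swap : ∀ {Γ a b φ} → (a ∷ b ∷ Γ) ⊢ φ → (b ∷ a ∷ Γ) ⊢ φ
  swap = weaken λ { (here e) → there (here e) ; (there (here e)) → here e
                  ; (there (there x∈Γ)) → there (there x∈Γ) }

  #0 : ∀ {Γ a} → (a ∷ Γ) ⊢ a
  #0 = hyp (here refl)

  #1 : ∀ {Γ a b} → (b ∷ a ∷ Γ) ⊢ a
  #1 = hyp (there (here refl))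

  #2 : ∀ {Γ a b c} → (c ∷ b ∷ a ∷ Γ) ⊢ a
  #2 = hyp (there (there (here refl)))

  ⇒-refl : ∀ {Γ} a → Γ ⊢ a ⇒ a
  ⇒-refl a = mp (mp (axiom (axS a (a ⇒ a) a)) (axiom (axK a (a ⇒ a)))) (axiom (axK a a))

  deduction : ∀ {Γ a b} → (a ∷ Γ) ⊢ b → Γ ⊢ a ⇒ b
  deduction {a = a} (thm b∈T)          = mp (axiom (axK _ a)) (thm b∈T)
  deduction {a = a} (hyp (here refl))  = ⇒-refl a
  deduction {a = a} (hyp (there b∈Γ)) = mp (axiom (axK _ a)) (hyp b∈Γ)
  deduction         (mp d e)           = mp (mp (axiom (axS _ _ _)) (deduction d)) (deduction e)

  ∧-intro : ∀ {Γ a b} → Γ ⊢ a → Γ ⊢ b → Γ ⊢ a ∧' b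
  ∧-intro d e = mp (mp (axiom (ax∧I _ _)) d) e

  ∧-elim₁ : ∀ {Γ a b} → Γ ⊢ a ∧' b → Γ ⊢ a
  ∧-elim₁ = mp (axiom (ax∧E₁ _ _))

  ∧-elim₂ : ∀ {Γ a b} → Γ ⊢ a ∧' b → Γ ⊢ b
  ∧-elim₂ = mp (axiom (ax∧E₂ _ _))

  ∨-intro₁ : ∀ {Γ a b} → Γ ⊢ a → Γ ⊢ a ∨' b
  ∨-intro₁ = mp (axiom (ax∨I₁ _ _))

  ∨-intro₂ : ∀ {Γ a b} → Γ ⊢ b → Γ ⊢ a ∨' b
  ∨-intro₂ = mp (axiom (ax∨I₂ _ _))

  ∨-elim : ∀ {Γ a b c} → Γ ⊢ a ∨' b → (a ∷ Γ) ⊢ c → (b ∷ Γ) ⊢ c → Γ ⊢ c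
  ∨-elim d e f = mp (mp (mp (axiom (ax∨E _ _ _)) (deduction e)) (deduction f)) d

  ex-falso : ∀ {Γ c} → Γ ⊢ ⊥' → Γ ⊢ c
  ex-falso = mp (axiom (ax⊥E _))

  ⊤-intro : ∀ {Γ} → Γ ⊢ ⊤'
  ⊤-intro = axiom ax⊤

  ¬¬-intro : ∀ {Γ a} → Γ ⊢ a → Γ ⊢ ¬' (¬' a)
  ¬¬-intro d = deduction (mp #0 (weaken₁ d))

  ¬¬-cases : ∀ {Γ a c} → (a ∷ Γ) ⊢ c → (¬' a ∷ Γ) ⊢ c → Γ ⊢ ¬' (¬' c)
  ¬¬-cases d e = deduction (mp #0 (mp (deduction (weaken-skip e))
                                      (deduction (mp #1 (weaken-skip d)))))

  ⇔-intro : ∀ {Γ a b} → (a ∷ Γ) ⊢ b → (b ∷ Γ) ⊢ a → Γ ⊢ a ⇔ b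
  ⇔-intro d e = ∧-intro (deduction d) (deduction e)

  ⇔-elim₁ : ∀ {Γ a b} → Γ ⊢ a ⇔ b → Γ ⊢ a → Γ ⊢ b
  ⇔-elim₁ a⇔b = mp (∧-elim₁ a⇔b)

  ⇔-elim₂ : ∀ {Γ a b} → Γ ⊢ a ⇔ b → Γ ⊢ b → Γ ⊢ a
  ⇔-elim₂ a⇔b = mp (∧-elim₂ a⇔b)

  ⇔-refl : ∀ {Γ a} → Γ ⊢ a ⇔ a
  ⇔-refl = ⇔-intro #0 #0

  ∧-cong : ∀ {Γ a a′ b b′} → Γ ⊢ a ⇔ a′ → Γ ⊢ b ⇔ b′ → Γ ⊢ (a ∧' b) ⇔ (a′ ∧' b′)
  ∧-cong a⇔a′ b⇔b′ =
    ⇔-intro (∧-intro (⇔-elim₁ (weaken₁ a⇔a′) (∧-elim₁ #0)) (⇔-elim₁ (weaken₁ b⇔b′) (∧-elim₂ #0)))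
            (∧-intro (⇔-elim₂ (weaken₁ a⇔a′) (∧-elim₁ #0)) (⇔-elim₂ (weaken₁ b⇔b′) (∧-elim₂ #0)))

  ∨-cong : ∀ {Γ a a′ b b′} → Γ ⊢ a ⇔ a′ → Γ ⊢ b ⇔ b′ → Γ ⊢ (a ∨' b) ⇔ (a′ ∨' b′)
  ∨-cong a⇔a′ b⇔b′ =
    ⇔-intro (∨-elim #0 (∨-intro₁ (⇔-elim₁ (weaken₁ (weaken₁ a⇔a′)) #0))
                       (∨-intro₂ (⇔-elim₁ (weaken₁ (weaken₁ b⇔b′)) #0)))
            (∨-elim #0 (∨-intro₁ (⇔-elim₂ (weaken₁ (weaken₁ a⇔a′)) #0))
                       (∨-intro₂ (⇔-elim₂ (weaken₁ (weaken₁ b⇔b′)) #0)))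

  ⇒-cong : ∀ {Γ a a′ b b′} → Γ ⊢ a ⇔ a′ → Γ ⊢ b ⇔ b′ → Γ ⊢ (a ⇒ b) ⇔ (a′ ⇒ b′)
  ⇒-cong a⇔a′ b⇔b′ =
    ⇔-intro (deduction (⇔-elim₁ (weaken₁ (weaken₁ b⇔b′)) (mp #1 (⇔-elim₂ (weaken₁ (weaken₁ a⇔a′)) #0))))
            (deduction (⇔-elim₂ (weaken₁ (weaken₁ b⇔b′)) (mp #1 (⇔-elim₁ (weaken₁ (weaken₁ a⇔a′)) #0))))

  sub-cong : ∀ {Γ σ τ} → (∀ p → Γ ⊢ σ p ⇔ τ p) → ∀ χ → Γ ⊢ sub σ χ ⇔ sub τ χ
  sub-cong σ⇔τ (var p)  = σ⇔τ p
  sub-cong σ⇔τ ⊥'       = ⇔-refl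
  sub-cong σ⇔τ ⊤'       = ⇔-refl
  sub-cong σ⇔τ (a ∧' b) = ∧-cong (sub-cong σ⇔τ a) (sub-cong σ⇔τ b)
  sub-cong σ⇔τ (a ∨' b) = ∨-cong (sub-cong σ⇔τ a) (sub-cong σ⇔τ b)
  sub-cong σ⇔τ (a ⇒ b)  = ⇒-cong (sub-cong σ⇔τ a) (sub-cong σ⇔τ b)

  ⇔-sub : ∀ {Γ τ} → (∀ p → Γ ⊢ var p ⇔ τ p) → ∀ χ → Γ ⊢ χ ⇔ sub τ χ
  ⇔-sub {Γ} {τ} var⇔τ χ = subst (λ ψ → Γ ⊢ ψ ⇔ sub τ χ) (sub-var χ) (sub-cong var⇔τ χ)

  Provable-as : Bool → Formula → Set
  Provable-as true  χ = [] ⊢ χ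
  Provable-as false χ = [] ⊢ ¬' χ

  kalmar : ∀ v χ → Provable-as (eval v χ) (sub (valuationSubst v) χ)
  kalmar v (var p) with v p
  ... | true  = ⊤-intro
  ... | false = ⇒-refl ⊥'
  kalmar v ⊥' = ⇒-refl ⊥'
  kalmar v ⊤' = ⊤-intro
  kalmar v (a ∧' b) = ∧-case (eval v a) (eval v b) (kalmar v a) (kalmar v b)
    where
    ∧-case : ∀ x y {a b} → Provable-as x a → Provable-as y b → Provable-as (x && y) (a ∧' b)
    ∧-case true  true  ⊢a ⊢b = ∧-intro ⊢a ⊢b
    ∧-case true  false ⊢a ⊢¬b = deduction (mp (weaken₁ ⊢¬b) (∧-elim₂ #0))
    ∧-case false y     ⊢¬a ⊢b = deduction (mp (weaken₁ ⊢¬a) (∧-elim₁ #0))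
  kalmar v (a ∨' b) = ∨-case (eval v a) (eval v b) (kalmar v a) (kalmar v b)
    where
    ∨-case : ∀ x y {a b} → Provable-as x a → Provable-as y b → Provable-as (x || y) (a ∨' b)
    ∨-case true  y     ⊢a  ⊢b  = ∨-intro₁ ⊢a
    ∨-case false true  ⊢¬a ⊢b  = ∨-intro₂ ⊢b
    ∨-case false false ⊢¬a ⊢¬b =
      deduction (∨-elim #0 (mp (weaken[] ⊢¬a) #0) (mp (weaken[] ⊢¬b) #0))
  kalmar v (a ⇒ b) = ⇒-case (eval v a) (eval v b) (kalmar v a) (kalmar v b)
    where
    ⇒-case : ∀ x y {a b} → Provable-as x a → Provable-as y b → Provable-as (not x || y) (a ⇒ b)
    ⇒-case true  true  ⊢a  ⊢b  = deduction (weaken₁ ⊢b)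
    ⇒-case true  false ⊢a  ⊢¬b = deduction (mp (weaken₁ ⊢¬b) (mp #0 (weaken₁ ⊢a)))
    ⇒-case false y     ⊢¬a ⊢b  = deduction (ex-falso (mp (weaken₁ ⊢¬a) #0))

  kalmar-true : ∀ {v χ} → eval v χ ≡ true → [] ⊢ sub (valuationSubst v) χ
  kalmar-true {v} {χ} eq = subst (λ x → Provable-as x (sub (valuationSubst v) χ)) eq (kalmar v χ)

  kalmar-false : ∀ {v χ} → eval v χ ≡ false → [] ⊢ ¬' (sub (valuationSubst v) χ)
  kalmar-false {v} {χ} eq = subst (λ x → Provable-as x (sub (valuationSubst v) χ)) eq (kalmar v χ)

  var⇔assign : ∀ {Γ} n c → Γ ⊢ var n ⇔ c → ∀ p → Γ ⊢ var p ⇔ assign n c p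
  var⇔assign n c n⇔c p with p ≟ n
  ... | yes refl = n⇔c
  ... | no  _    = ⇔-refl

  ¬-by-assigning : ∀ n χ → [] ⊢ ¬' (sub (assign n ⊤') χ) → [] ⊢ ¬' (sub (assign n ⊥') χ) →
                   [] ⊢ ¬' χ
  ¬-by-assigning n χ ¬χ[⊤] ¬χ[⊥] = deduction (mp (¬¬-cases χ,n⊢⊥ χ,¬n⊢⊥) (⇒-refl ⊥'))
    where
    χ,n⊢⊥ : (var n ∷ χ ∷ []) ⊢ ⊥'
    χ,n⊢⊥ = mp (weaken[] ¬χ[⊤]) (⇔-elim₁ (⇔-sub (var⇔assign n ⊤' (⇔-intro ⊤-intro #1)) χ) #1)
    χ,¬n⊢⊥ : (¬' (var n) ∷ χ ∷ []) ⊢ ⊥'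
    χ,¬n⊢⊥ = mp (weaken[] ¬χ[⊥]) (⇔-elim₁ (⇔-sub (var⇔assign n ⊥' (⇔-intro (mp #1 #0) (ex-falso #0))) χ) #1)

  satisfiable-or-refutable : ∀ n χ → VarsBelow n χ → Satisfiable χ ⊎ [] ⊢ ¬' χ
  satisfiable-or-refutable zero χ χ-closed with eval (λ _ → false) χ in eq
  ... | true  = inj₁ (_ , eq)
  ... | false = inj₂ (subst (λ ψ → [] ⊢ ¬' ψ) (sub-closed _ χ χ-closed) (kalmar-false {χ = χ} eq))
  satisfiable-or-refutable (suc n) χ χ<1+n
    with satisfiable-or-refutable n (sub (assign n ⊤') χ) (VarsBelow-sub χ χ<1+n (VarsBelow-assign n ⊤' tt))
  ... | inj₁ (v , eq) = inj₁ (eval v ∘ assign n ⊤' , trans (sym (eval-sub v (assign n ⊤') χ)) eq)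
  ... | inj₂ ¬χ[⊤]
    with satisfiable-or-refutable n (sub (assign n ⊥') χ) (VarsBelow-sub χ χ<1+n (VarsBelow-assign n ⊥' tt))
  ...   | inj₁ (v , eq) = inj₁ (eval v ∘ assign n ⊥' , trans (sym (eval-sub v (assign n ⊥') χ)) eq)
  ...   | inj₂ ¬χ[⊥]    = inj₂ (¬-by-assigning n χ ¬χ[⊤] ¬χ[⊥])

  consistent⇒satisfiable : ∀ {χ} → Consistent T χ → Satisfiable χ
  consistent⇒satisfiable {χ} χ-consistent
    with satisfiable-or-refutable (varBound χ) χ (VarsBelow-varBound χ)
  ... | inj₁ χ-sat = χ-sat
  ... | inj₂ ⊢¬χ  = ⊥-elim (χ-consistent (⊢⇒T ⊢¬χ))

module StableProjectivity (T : Theory) (IPC⊆T : IPC ⊆ T) (T-closedMP : ClosedMP T) where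

  open Derivations T IPC⊆T T-closedMP

  IsStable : Formula → Set
  IsStable a = T (a ⇔ ¬' (¬' a))

  stable-elim : ∀ {Γ a} → IsStable a → Γ ⊢ ¬' (¬' a) → Γ ⊢ a
  stable-elim a-stable = ⇔-elim₂ (thm a-stable)

  stable-⊥ : IsStable ⊥'
  stable-⊥ = ⊢⇒T (⇔-intro (¬¬-intro #0) (mp #0 (⇒-refl ⊥')))

  stable-⇒ : ∀ {a b} → IsStable b → IsStable (a ⇒ b)
  stable-⇒ b-stable = ⊢⇒T (⇔-intro (¬¬-intro #0)
    (deduction (stable-elim b-stable (deduction (mp #2 (deduction (mp #1 (mp #0 #2))))))))

  stable-∧ : ∀ {a b} → IsStable a → IsStable b → IsStable (a ∧' b)
  stable-∧ a-stable b-stable = ⊢⇒T (⇔-intro (¬¬-intro #0)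
    (∧-intro (stable-elim a-stable (deduction (mp #1 (deduction (mp #1 (∧-elim₁ #0))))))
             (stable-elim b-stable (deduction (mp #1 (deduction (mp #1 (∧-elim₂ #0))))))))

  ¬¬-premise : ∀ {Γ φ b} → IsStable b → (φ ∷ Γ) ⊢ b → (¬' (¬' φ) ∷ Γ) ⊢ b
  ¬¬-premise b-stable φ⊢b =
    stable-elim b-stable (deduction (mp #1 (deduction (mp #1 (weaken-skip (weaken-skip φ⊢b))))))

  ProjectsVia : Formula → Subst → Set
  ProjectsVia φ σ = ∀ p → ((φ ∷ σ p ∷ []) ⊢ var p) × ((φ ∷ var p ∷ []) ⊢ σ p)

  var⇔projection : ∀ {φ σ} → ProjectsVia φ σ → ∀ p → (φ ∷ []) ⊢ var p ⇔ σ p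
  var⇔projection projects p = ⇔-intro (swap (proj₂ (projects p))) (swap (proj₁ (projects p)))

  projective⇒stable : Stable T var → ∀ {φ} → STProjective T φ → IsStable φ
  projective⇒stable var-stable {φ} (σ , σ-stable , ⊢σφ , projects) =
    ⊢⇒T (⇔-intro (¬¬-intro #0) (⇔-elim₂ (⇔-sub ¬¬φ⊢p⇔σp φ) (weaken[] (thm ⊢σφ))))
    where
    ¬¬φ⊢p⇔σp : ∀ p → (¬' (¬' φ) ∷ []) ⊢ var p ⇔ σ p
    ¬¬φ⊢p⇔σp p = ⇔-intro (swap (¬¬-premise (σ-stable p) (proj₂ (projects p))))
                         (swap (¬¬-premise (var-stable p) (proj₁ (projects p))))

  unifier : Formula → (ℕ → Bool) → Subst
  unifier φ v p = if v p then φ ⇒ var p else φ ∧' var p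

  unifier-stable : Stable T var → ∀ {φ} v → IsStable φ → Stable T (unifier φ v)
  unifier-stable var-stable v φ-stable p with v p
  ... | true  = stable-⇒ (var-stable p)
  ... | false = stable-∧ φ-stable (var-stable p)

  unifier-projects : ∀ φ v → ProjectsVia φ (unifier φ v)
  unifier-projects φ v p with v p
  ... | true  = mp #1 #0 , deduction #2
  ... | false = ∧-elim₂ #1 , ∧-intro #0 #1

  unifier⇔valuation : ∀ φ v p → (¬' φ ∷ []) ⊢ unifier φ v p ⇔ valuationSubst v p
  unifier⇔valuation φ v p with v p
  ... | true  = ⇔-intro ⊤-intro (deduction (ex-falso (mp #2 #0)))
  ... | false = ⇔-intro (mp #1 (∧-elim₁ #0)) (ex-falso #0)

  unifier-unifies : Stable T var → (∀ σ → Stable T σ → ∀ χ → T χ → T (sub σ χ)) →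
                    ∀ {φ v} → IsStable φ → eval v φ ≡ true → T (sub (unifier φ v) φ)
  unifier-unifies var-stable stable-closed {φ} {v} φ-stable φ[v] =
    ⊢⇒T (stable-elim σφ-stable (¬¬-cases φ⊢σφ ¬φ⊢σφ))
    where
    σφ-stable : IsStable (sub (unifier φ v) φ)
    σφ-stable = stable-closed (unifier φ v) (unifier-stable var-stable v φ-stable) _ φ-stable
    φ⊢σφ : (φ ∷ []) ⊢ sub (unifier φ v) φ
    φ⊢σφ = ⇔-elim₁ (⇔-sub (var⇔projection (unifier-projects φ v)) φ) #0
    ¬φ⊢σφ : (¬' φ ∷ []) ⊢ sub (unifier φ v) φ
    ¬φ⊢σφ = ⇔-elim₂ (sub-cong (unifier⇔valuation φ v) φ) (weaken[] (kalmar-true {v} {φ} φ[v]))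

  stable⇒projective : Stable T var → (∀ σ → Stable T σ → ∀ χ → T χ → T (sub σ χ)) →
                      ∀ {φ} → Consistent T φ → IsStable φ → STProjective T φ
  stable⇒projective var-stable stable-closed {φ} φ-consistent φ-stable =
    let (v , φ[v]) = consistent⇒satisfiable φ-consistent in
    unifier φ v , unifier-stable var-stable v φ-stable ,
    unifier-unifies var-stable stable-closed φ-stable φ[v] , unifier-projects φ v

module NegativeVariant (L : Theory) (L-logic : IntermediateLogic L) where

  open IntermediateLogic L-logic
  open IntermediateTheory intermediate
  open StableProjectivity L ipc⊆ closedMP
  open Derivations L ipc⊆ closedMP

  Neg-IPC⊆ : IPC ⊆ Neg L
  Neg-IPC⊆ φ ⊢φ = closedSubst neg-var φ (ipc⊆ φ ⊢φ)

  Neg-closedMP : ClosedMP (Neg L)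
  Neg-closedMP φ ψ = closedMP (φ ^¬) (ψ ^¬)

  Neg-var-stable : Stable (Neg L) var
  Neg-var-stable p = stable-⇒ stable-⊥

  -- Substituting ¬(σ p)^¬ into χ^¬ yields χ with p ↦ ¬¬(σ p)^¬, which the stability of σ
  -- turns into (σ χ)^¬.
  Neg-stable-closed : ∀ σ → Stable (Neg L) σ → ∀ χ → Neg L χ → Neg L (sub σ χ)
  Neg-stable-closed σ σ-stable χ χ^¬∈L =
    subst L (sym (sub-sub neg-var σ χ))
      (⊢⇒T (⇔-elim₂ (sub-cong (λ p → thm (σ-stable p)) χ)
                    (thm (subst L (sub-sub ρ neg-var χ) (closedSubst ρ (χ ^¬) χ^¬∈L)))))
    where
    ρ : Subst
    ρ p = ¬' (σ p ^¬)

lemma4p7 : (L : Theory) → IntermediateLogic L → ND ⊆ L →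
    (φ : Formula) → Consistent (Neg L) φ →
    (Neg L (φ ⇔ ¬' (¬' φ)) → STProjective (Neg L) φ) ×
    (STProjective (Neg L) φ → Neg L (φ ⇔ ¬' (¬' φ)))
lemma4p7 L L-logic _ φ φ-consistent =
  stable⇒projective Neg-var-stable Neg-stable-closed φ-consistent ,
  projective⇒stable Neg-var-stable
  where
  open NegativeVariant L L-logic
  open StableProjectivity (Neg L) Neg-IPC⊆ Neg-closedMP
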